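{- For every $n\ge1$, $\mathrm{KrInt}(n)$ is exactly the set of partitions of $[n]$ of the form $\{Q\sqcup\{n\}\}\cup\{\{i\}:i\in[n-1]\setminus Q\}$ with $Q\subseteq[n-1]$; that is, each element of $\mathrm{KrInt}(n)$ has at most one block of size $\ge2$, which (if present) contains $n$, and every subset $Q\subseteq[n-1]$ arises, giving a bijection $Q\mapsto$ (partition with block $Q\sqcup\{n\}$ and all other blocks singletons).
   Context: $\mathrm{NC}(n)$ is the set of non-crossing partitions of $[n]$, identified with permutations whose cycles are the blocks with elements in increasing order; $\mathrm{Int}(n)$ is the set of interval partitions of $[n]$ (blocks of consecutive integers). With $\gamma_n=(1\,2\,\cdots\,n)$, the Kreweras complement of $\alpha\in\mathrm{NC}(n)$ is $\alpha^{\mathrm{Kr}}=\alpha^{ -1}\gamma_n$ (equivalently, the largest non-crossing partition of $\{\bar1,\dots,\bar n\}$ such that $\alpha\sqcup\alpha^{\mathrm{Kr}}$ is non-crossing on $1<\bar1<2<\bar2<\dots<n<\bar n$), and $\mathrm{KrInt}(n)=\{\alpha^{\mathrm{Kr}}:\alpha\in\mathrm{Int}(n)\}$. -}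

module Defs where

open import Data.Nat using (ℕ; zero; suc; _<_; _<?_)
open import Data.Nat.Properties using ()
open import Data.Fin using (Fin; toℕ; fromℕ; inject₁)
open import Data.List using (List; []; _∷_; filter; head; last; allFin)
open import Data.Maybe using (Maybe; just; nothing)
open import Data.Bool using (Bool; true; false; if_then_else_)
open import Data.Vec using () renaming (_∷_ to _∷ᵥ_; [] to [])
import Data.Fin as Fin
open import Data.Fin.Subset using (Subset)
open import Relation.Nullary.Decidable using (_×-dec_)
open import Relation.Binary.PropositionalEquality using (_≡_)
import Data.Nat.Properties as ℕP
open import Function using (_∘_)

-- A set partition of [n] = Fin n is given by a block labelling b : Fin n → ℕ;
-- i and j lie in the same block iff b i ≡ b j.
Labelling : ℕ → Set
Labelling n = Fin n → ℕ

firstOr : ∀ {n} → Fin n → List (Fin n) → Fin n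
firstOr d xs with head xs
... | just x  = x
... | nothing = d

lastOr : ∀ {n} → Fin n → List (Fin n) → Fin n
lastOr d xs with last xs
... | just x  = x
... | nothing = d

-- The permutation associated with a partition: each block is a cycle with its
-- elements in increasing order (i ↦ next larger element of its block, or the
-- minimum of the block if i is the maximum).
perm : ∀ {n} → Labelling n → Fin n → Fin n
perm {n} b i =
  firstOr (firstOr i (filter (λ j → b j ℕP.≟ b i) (allFin n)))
          (filter (λ j → (toℕ i <? toℕ j) ×-dec (b j ℕP.≟ b i)) (allFin n))

permInv : ∀ {n} → Labelling n → Fin n → Fin n
permInv {n} b i =
  lastOr (lastOr i (filter (λ j → b j ℕP.≟ b i) (allFin n)))
         (filter (λ j → (toℕ j <? toℕ i) ×-dec (b j ℕP.≟ b i)) (allFin n))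

-- The long cycle γ_n = (1 2 ... n), on Fin n (0-indexed): i ↦ i+1, last ↦ first.
γ : ∀ {n} → Fin n → Fin n
γ {n} i = firstOr i (firstOr' (filter (λ j → toℕ i <? toℕ j) (allFin n)))
  where
  firstOr' : List (Fin n) → List (Fin n)
  firstOr' [] = filter (λ j → toℕ j <? 1) (allFin n)
  firstOr' (x ∷ xs) = x ∷ xs

IsInterval : ∀ {n} → Labelling n → Set
IsInterval {n} b = ∀ (i j k : Fin n) → toℕ i < toℕ j → toℕ j < toℕ k →
                   b i ≡ b k → b j ≡ b i

Kr : ∀ {n} → Labelling n → Fin n → Fin n
Kr b = permInv b ∘ γ

InKrInt : ∀ n → (Fin n → Fin n) → Set
InKrInt n σ = Σ' (Labelling n) (λ b → IsInterval b) (λ b → ∀ i → σ i ≡ Kr b i)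
  where
  open import Data.Product using (Σ; _×_)
  Σ' : (A : Set) → (A → Set) → (A → Set) → Set
  Σ' A P R = Σ A (λ a → P a × R a)

-- For Q ⊆ [n-1] (n = suc m; Q : Subset m is a subset of the first m elements),
-- inBig Q i says whether i lies in the block Q ⊔ {n}.
inBig : ∀ {m} → Subset m → Fin (suc m) → Bool
inBig [] Fin.zero = true
inBig (q ∷ᵥ Q) Fin.zero = q
inBig (q ∷ᵥ Q) (Fin.suc i) = inBig Q i

partQ : ∀ {m} → Subset m → Labelling (suc m)
partQ Q i = if inBig Q i then 0 else suc (toℕ i)

-- For an interval partition α, the permutation α⁻¹γ fixes every i that is not the last element
-- of its block, since γ moves i to i + 1 and α⁻¹ moves it back. The last element of a block is sent
-- by γ to the first element of the next block (cyclically), and α⁻¹ sends that to the last element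
-- of the same block. So α^Kr cycles through the block ends of α in increasing order: it is the
-- partition whose only big block is the set of block ends, i.e. Q ⊔ {n} with Q the block ends
-- below n. Cutting [n] right after each element of Q gives an interval partition with exactly
-- these block ends, and Q is recovered from the permutation as its moved points below n.

module Submission where

open import Defs
open import Data.Nat using (ℕ; zero; suc; _<_; _≤_; _<?_; _+_; _∸_; z≤n; s≤s; s≤s⁻¹)
open import Data.Fin using (Fin; toℕ; inject₁; fromℕ; fromℕ<)
import Data.Fin as Fin
import Data.Nat.Properties as ℕ
open import Data.Fin.Properties
  using (toℕ-injective; toℕ<n; toℕ-fromℕ; toℕ-fromℕ<; toℕ-inject₁; inject₁ℕ<)
open import Data.Fin.Subset using (Subset)
open import Data.List using (List; []; _∷_; filter; head; last; tabulate; allFin)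
open import Data.List.Properties using (filter-none)
open import Data.List.Relation.Unary.All.Properties using (tabulate⁺)
open import Data.Maybe using (just)
open import Data.Bool using (true; false; if_then_else_; not)
import Data.Bool.Properties as Bool
open import Data.Bool.Properties using (¬-not)
open import Data.Vec using (lookup) renaming (_∷_ to _∷ᵥ_; [] to []ᵥ)
import Data.Vec as Vec
open import Data.Vec.Properties using (lookup∘tabulate; tabulate∘lookup; tabulate-cong)
open import Data.Product using (Σ; _×_; _,_)
open import Data.Sum using (_⊎_; inj₁; inj₂)
open import Data.Empty using (⊥)
open import Relation.Nullary using (¬_; Dec; yes; no; does; contradiction)
open import Relation.Nullary.Decidable using (_×-dec_; dec-true; dec-false; decidable-stable)
open import Relation.Unary using (Pred; Decidable; ∁)
open import Relation.Binary.PropositionalEquality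
open import Function using (_∘_; id)

last-∷ : ∀ {a} {A : Set a} {y z : A} {xs : List A} → last xs ≡ just z → last (y ∷ xs) ≡ just z
last-∷ {xs = _ ∷ _} eq = eq

module _ {a p} {A : Set a} {P : Pred A p} (P? : Decidable P) where

  head-filter-tabulate : ∀ {n} (f : Fin n → A) (x : Fin n) → P (f x) →
                         (∀ j → toℕ j < toℕ x → ¬ P (f j)) →
                         head (filter P? (tabulate f)) ≡ just (f x)
  head-filter-tabulate f Fin.zero px _ with P? (f Fin.zero)
  ... | yes _  = refl
  ... | no ¬px = contradiction px ¬px
  head-filter-tabulate f (Fin.suc x) px earlier with P? (f Fin.zero)
  ... | yes p0 = contradiction p0 (earlier Fin.zero (s≤s z≤n))
  ... | no _   = head-filter-tabulate (f ∘ Fin.suc) x px (λ j j<x → earlier (Fin.suc j) (s≤s j<x))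

  filter-tabulate-none : ∀ {n} (f : Fin n → A) → (∀ j → ¬ P (f j)) → filter P? (tabulate f) ≡ []
  filter-tabulate-none f none = filter-none P? (tabulate⁺ {P = ∁ P} none)

  last-filter-tabulate : ∀ {n} (f : Fin n → A) (x : Fin n) → P (f x) →
                         (∀ j → toℕ x < toℕ j → ¬ P (f j)) →
                         last (filter P? (tabulate f)) ≡ just (f x)
  last-filter-tabulate f Fin.zero px later with P? (f Fin.zero)
  ... | no ¬px = contradiction px ¬px
  ... | yes _ rewrite filter-tabulate-none (f ∘ Fin.suc) (λ j → later (Fin.suc j) (s≤s z≤n)) = refl
  last-filter-tabulate f (Fin.suc x) px later with P? (f Fin.zero)
  ... | yes _ = last-∷ {y = f Fin.zero} {xs = filter P? (tabulate (f ∘ Fin.suc))}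
                  (last-filter-tabulate (f ∘ Fin.suc) x px (λ j x<j → later (Fin.suc j) (s≤s x<j)))
  ... | no _  = last-filter-tabulate (f ∘ Fin.suc) x px (λ j x<j → later (Fin.suc j) (s≤s x<j))

  least? : ∀ {n} (f : Fin n → A) →
           (∀ j → ¬ P (f j)) ⊎ Σ (Fin n) (λ x → P (f x) × (∀ j → toℕ j < toℕ x → ¬ P (f j)))
  least? {zero} f = inj₁ (λ ())
  least? {suc n} f with P? (f Fin.zero) | least? (f ∘ Fin.suc)
  ... | yes p0 | _                    = inj₂ (Fin.zero , p0 , λ _ ())
  ... | no ¬p0 | inj₁ none            = inj₁ λ { Fin.zero → ¬p0 ; (Fin.suc j) → none j }
  ... | no ¬p0 | inj₂ (x , px , less) =
    inj₂ (Fin.suc x , px , λ { Fin.zero _ → ¬p0 ; (Fin.suc j) (s≤s j<x) → less j j<x })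

firstOr-just : ∀ {n} {d x : Fin n} xs → head xs ≡ just x → firstOr d xs ≡ x
firstOr-just _ eq rewrite eq = refl

lastOr-just : ∀ {n} {d x : Fin n} xs → last xs ≡ just x → lastOr d xs ≡ x
lastOr-just _ eq rewrite eq = refl

module _ {n} (b : Labelling n) where

  private
    sameBlock? : (i j : Fin n) → Dec (b j ≡ b i)
    sameBlock? i j = b j ℕ.≟ b i

    laterInBlock? : (i j : Fin n) → Dec (toℕ i < toℕ j × b j ≡ b i)
    laterInBlock? i j = (toℕ i <? toℕ j) ×-dec (b j ℕ.≟ b i)

    earlierInBlock? : (i j : Fin n) → Dec (toℕ j < toℕ i × b j ≡ b i)
    earlierInBlock? i j = (toℕ j <? toℕ i) ×-dec (b j ℕ.≟ b i)

  perm-next : ∀ {i x} → toℕ i < toℕ x → b x ≡ b i →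
              (∀ k → toℕ i < toℕ k → toℕ k < toℕ x → b k ≢ b i) → perm b i ≡ x
  perm-next {i} {x} i<x same between =
    firstOr-just (filter (laterInBlock? i) (allFin n))
      (head-filter-tabulate (laterInBlock? i) id x (i<x , same)
        (λ k k<x (i<k , same′) → between k i<k k<x same′))

  perm-wrap : ∀ {i x} → (∀ k → toℕ i < toℕ k → b k ≢ b i) → b x ≡ b i →
              (∀ k → toℕ k < toℕ x → b k ≢ b i) → perm b i ≡ x
  perm-wrap {i} {x} last same first =
    trans (cong (firstOr _) (filter-tabulate-none (laterInBlock? i) id (λ k (i<k , same′) → last k i<k same′)))
          (firstOr-just (filter (sameBlock? i) (allFin n)) (head-filter-tabulate (sameBlock? i) id x same first))

  permInv-prev : ∀ {x y} → toℕ x < toℕ y → b x ≡ b y →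
                 (∀ k → toℕ x < toℕ k → toℕ k < toℕ y → b k ≢ b y) → permInv b y ≡ x
  permInv-prev {x} {y} x<y same between =
    lastOr-just (filter (earlierInBlock? y) (allFin n))
      (last-filter-tabulate (earlierInBlock? y) id x (x<y , same)
        (λ k x<k (k<y , same′) → between k x<k k<y same′))

  permInv-wrap : ∀ {x y} → (∀ k → toℕ k < toℕ y → b k ≢ b y) → b x ≡ b y →
                 (∀ k → toℕ x < toℕ k → b k ≢ b y) → permInv b y ≡ x
  permInv-wrap {x} {y} first same last =
    trans (cong (lastOr _) (filter-tabulate-none (earlierInBlock? y) id (λ k (k<y , same′) → first k k<y same′)))
          (lastOr-just (filter (sameBlock? y) (allFin n)) (last-filter-tabulate (sameBlock? y) id x same last))

nothing-between : ∀ {n} {i j k : Fin n} → toℕ j ≡ suc (toℕ i) → toℕ i < toℕ k → toℕ k < toℕ j → ⊥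
nothing-between {k = k} j≡1+i i<k k<j = ℕ.<⇒≱ i<k (s≤s⁻¹ (subst (toℕ k <_) j≡1+i k<j))

last-maximal : ∀ {m} {i k : Fin (suc m)} → toℕ i ≡ m → toℕ k ≤ toℕ i
last-maximal {k = k} i≡m = subst (toℕ k ≤_) (sym i≡m) (s≤s⁻¹ (toℕ<n k))

γ-suc : ∀ {n} {i j : Fin n} → toℕ j ≡ suc (toℕ i) → γ i ≡ j
γ-suc {n} {i} {j} j≡1+i
  with filter (λ k → toℕ i <? toℕ k) (allFin n)
     | head-filter-tabulate (λ k → toℕ i <? toℕ k) id j (ℕ.≤-reflexive (sym j≡1+i))
         (λ k k<j i<k → nothing-between j≡1+i i<k k<j)
... | .j ∷ _ | refl = refl

γ-last : ∀ {m} {i : Fin (suc m)} → toℕ i ≡ m → γ i ≡ Fin.zero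
γ-last {m} {i} i≡m
  with filter (λ k → toℕ i <? toℕ k) (allFin (suc m))
     | filter-tabulate-none (λ k → toℕ i <? toℕ k) id
         (λ k i<k → ℕ.<⇒≱ i<k (last-maximal i≡m))
... | .[] | refl =
  firstOr-just {d = i} (filter (λ k → toℕ k <? 1) (allFin (suc m)))
    (head-filter-tabulate (λ k → toℕ k <? 1) id Fin.zero (s≤s z≤n) (λ _ ()))

inBig-last : ∀ {m} (Q : Subset m) (i : Fin (suc m)) → toℕ i ≡ m → inBig Q i ≡ true
inBig-last []ᵥ       Fin.zero    _   = refl
inBig-last (_ ∷ᵥ Q) (Fin.suc i) i≡m = inBig-last Q i (ℕ.suc-injective i≡m)

inBig-inject₁ : ∀ {m} (Q : Subset m) (k : Fin m) → inBig Q (inject₁ k) ≡ lookup Q k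
inBig-inject₁ (_ ∷ᵥ _) Fin.zero    = refl
inBig-inject₁ (_ ∷ᵥ Q) (Fin.suc k) = inBig-inject₁ Q k

module _ {m} (Q : Subset m) where

  private
    if-0 : ∀ c {k} → (if c then 0 else suc k) ≡ 0 → c ≡ true
    if-0 true  _ = refl

    if-suc : ∀ c {k l} → (if c then 0 else suc k) ≡ suc l → k ≡ l
    if-suc false eq = ℕ.suc-injective eq

    partQ-big : ∀ {i} → inBig Q i ≡ true → partQ Q i ≡ 0
    partQ-big big rewrite big = refl

    partQ-small : ∀ {i} → inBig Q i ≡ false → partQ Q i ≡ suc (toℕ i)
    partQ-small small rewrite small = refl

  partQ-sameBlock-big : ∀ {i j} → inBig Q i ≡ true → partQ Q j ≡ partQ Q i → inBig Q j ≡ true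
  partQ-sameBlock-big {j = j} big same = if-0 (inBig Q j) (trans same (partQ-big big))

  partQ-sameBlock-small : ∀ {i j} → inBig Q i ≡ false → partQ Q j ≡ partQ Q i → j ≡ i
  partQ-sameBlock-small {j = j} small same = toℕ-injective (if-suc (inBig Q j) (trans same (partQ-small small)))

  perm-partQ-small : ∀ {i} → inBig Q i ≡ false → perm (partQ Q) i ≡ i
  perm-partQ-small small =
    perm-wrap (partQ Q) (λ k i<k same → ℕ.<-irrefl (cong toℕ (sym (partQ-sameBlock-small small same))) i<k)
              refl (λ k k<i same → ℕ.<-irrefl (cong toℕ (partQ-sameBlock-small small same)) k<i)

  perm-partQ-next : ∀ {i x} → inBig Q i ≡ true → toℕ i < toℕ x → inBig Q x ≡ true →
                    (∀ k → toℕ i < toℕ k → toℕ k < toℕ x → inBig Q k ≢ true) → perm (partQ Q) i ≡ x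
  perm-partQ-next big i<x bigˣ between =
    perm-next (partQ Q) i<x (trans (partQ-big bigˣ) (sym (partQ-big big)))
              (λ k i<k k<x same → between k i<k k<x (partQ-sameBlock-big big same))

  perm-partQ-wrap : ∀ {i x} → inBig Q i ≡ true → (∀ k → toℕ i < toℕ k → inBig Q k ≢ true) →
                    inBig Q x ≡ true → (∀ k → toℕ k < toℕ x → inBig Q k ≢ true) → perm (partQ Q) i ≡ x
  perm-partQ-wrap big last bigˣ first =
    perm-wrap (partQ Q) (λ k i<k same → last k i<k (partQ-sameBlock-big big same))
              (trans (partQ-big bigˣ) (sym (partQ-big big)))
              (λ k k<x same → first k k<x (partQ-sameBlock-big big same))

  record NextBig (y : Fin (suc m)) : Set where
    field
      next     : Fin (suc m)
      y≤next   : toℕ y ≤ toℕ next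
      isBig    : inBig Q next ≡ true
      skipped  : ∀ k → toℕ y ≤ toℕ k → toℕ k < toℕ next → inBig Q k ≢ true

  nextBig : ∀ y → NextBig y
  nextBig y with least? (λ k → (toℕ y ℕ.≤? toℕ k) ×-dec (inBig Q k Bool.≟ true)) id
  ... | inj₁ none = contradiction (y≤m , inBig-last Q (fromℕ m) (toℕ-fromℕ m)) (none (fromℕ m))
    where
    y≤m : toℕ y ≤ toℕ (fromℕ m)
    y≤m = subst (toℕ y ≤_) (sym (toℕ-fromℕ m)) (s≤s⁻¹ (toℕ<n y))
  ... | inj₂ (x , (y≤x , bigˣ) , less) =
    record { next = x ; y≤next = y≤x ; isBig = bigˣ
           ; skipped = λ k y≤k k<x bigᵏ → less k k<x (y≤k , bigᵏ) }

  nextBig-after : ∀ {i y : Fin (suc m)} → toℕ y ≡ suc (toℕ i) → toℕ i < toℕ (NextBig.next (nextBig y))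
  nextBig-after {y = y} y≡1+i = subst (_≤ toℕ next) y≡1+i y≤next
    where open NextBig (nextBig y)

  perm-partQ-big : ∀ {i y} → inBig Q i ≡ true → toℕ y ≡ suc (toℕ i) →
                   perm (partQ Q) i ≡ NextBig.next (nextBig y)
  perm-partQ-big {y = y} big y≡1+i =
    perm-partQ-next big (nextBig-after y≡1+i) isBig (λ k i<k → skipped k (subst (_≤ toℕ k) (sym y≡1+i) i<k))
    where open NextBig (nextBig y)

record BlockEnds {m} (b : Labelling (suc m)) (Q : Subset m) : Set where
  field
    continues : ∀ k → lookup Q k ≡ false → b (inject₁ k) ≡ b (Fin.suc k)
    breaks    : ∀ k → lookup Q k ≡ true → b (inject₁ k) ≢ b (Fin.suc k)

adjacent : ∀ {m} {i j : Fin (suc m)} → toℕ j ≡ suc (toℕ i) →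
           Σ (Fin m) λ k → inject₁ k ≡ i × Fin.suc k ≡ j
adjacent {j = Fin.suc k} j≡1+i = k , toℕ-injective (trans (toℕ-inject₁ k) (ℕ.suc-injective j≡1+i)) , refl

module KrewerasOfInterval {m} {b : Labelling (suc m)} (interval : IsInterval b)
                          {Q : Subset m} (ends : BlockEnds b Q) where

  open BlockEnds ends
  open NextBig

  continues′ : ∀ {i j} → toℕ j ≡ suc (toℕ i) → inBig Q i ≡ false → b i ≡ b j
  continues′ j≡1+i small with adjacent j≡1+i
  ... | k , refl , refl = continues k (trans (sym (inBig-inject₁ Q k)) small)

  breaks′ : ∀ {i j} → toℕ j ≡ suc (toℕ i) → inBig Q i ≡ true → b i ≢ b j
  breaks′ j≡1+i big with adjacent j≡1+i
  ... | k , refl , refl = breaks k (trans (sym (inBig-inject₁ Q k)) big)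

  interval-closed : ∀ {i j k} → toℕ i ≤ toℕ j → toℕ j ≤ toℕ k → b i ≡ b k → b j ≡ b i
  interval-closed {i} {j} {k} i≤j j≤k same with ℕ.m≤n⇒m<n∨m≡n i≤j | ℕ.m≤n⇒m<n∨m≡n j≤k
  ... | inj₂ i≡j | _        = cong b (toℕ-injective (sym i≡j))
  ... | inj₁ _   | inj₂ j≡k = trans (cong b (toℕ-injective j≡k)) (sym same)
  ... | inj₁ i<j | inj₁ j<k = interval i j k i<j j<k same

  separated : ∀ {u j k} → inBig Q u ≡ true → toℕ j ≤ toℕ u → toℕ u < toℕ k → b j ≢ b k
  separated {u} {j} {k} big j≤u u<k same =
    breaks′ u′≡1+u big (trans (interval-closed j≤u (ℕ.<⇒≤ u<k) same)
                              (sym (interval-closed j≤u′ u′≤k same)))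
    where
    u′ : Fin (suc m)
    u′ = fromℕ< (ℕ.≤-<-trans u<k (toℕ<n k))
    u′≡1+u : toℕ u′ ≡ suc (toℕ u)
    u′≡1+u = toℕ-fromℕ< (ℕ.≤-<-trans u<k (toℕ<n k))
    u′≤k : toℕ u′ ≤ toℕ k
    u′≤k = subst (_≤ toℕ k) (sym u′≡1+u) u<k
    j≤u′ : toℕ j ≤ toℕ u′
    j≤u′ = subst (toℕ j ≤_) (sym u′≡1+u) (ℕ.m≤n⇒m≤1+n j≤u)

  same-block : ∀ {y x} → toℕ y ≤ toℕ x →
               (∀ k → toℕ y ≤ toℕ k → toℕ k < toℕ x → inBig Q k ≢ true) → b x ≡ b y
  same-block {y} {x} y≤x = go (toℕ x ∸ toℕ y) x (sym (ℕ.m∸n+n≡m y≤x))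
    where
    go : ∀ d z → toℕ z ≡ d + toℕ y →
         (∀ k → toℕ y ≤ toℕ k → toℕ k < toℕ z → inBig Q k ≢ true) → b z ≡ b y
    go zero    z z≡y _       = cong b (toℕ-injective z≡y)
    go (suc d) z z≡ skipped =
      trans (sym (continues′ z≡1+p (¬-not (skipped p y≤p p<z))))
            (go d p p≡ (λ k y≤k k<p → skipped k y≤k (ℕ.<-trans k<p p<z)))
      where
      d+y<1+m : d + toℕ y < suc m
      d+y<1+m = ℕ.<-trans (ℕ.n<1+n _) (subst (_< suc m) z≡ (toℕ<n z))
      p : Fin (suc m)
      p = fromℕ< d+y<1+m
      p≡ : toℕ p ≡ d + toℕ y
      p≡ = toℕ-fromℕ< d+y<1+m
      z≡1+p : toℕ z ≡ suc (toℕ p)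
      z≡1+p = trans z≡ (cong suc (sym p≡))
      y≤p : toℕ y ≤ toℕ p
      y≤p = subst (toℕ y ≤_) (sym p≡) (ℕ.m≤n+m _ d)
      p<z : toℕ p < toℕ z
      p<z = ℕ.≤-reflexive (sym z≡1+p)

  permInv-blockStart : ∀ {y} → (∀ j → toℕ j < toℕ y → b j ≢ b y) →
                       (nb : NextBig Q y) → permInv b y ≡ next nb
  permInv-blockStart start nb =
    permInv-wrap b start b[next]≡b[y]
      (λ k next<k same → separated (isBig nb) ℕ.≤-refl next<k (trans b[next]≡b[y] (sym same)))
    where
    b[next]≡b[y] : b (next nb) ≡ b _
    b[next]≡b[y] = same-block (y≤next nb) (skipped nb)

  Kr-beforeLast : ∀ {i y} → toℕ y ≡ suc (toℕ i) → Kr b i ≡ perm (partQ Q) i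
  Kr-beforeLast {i} {y} y≡1+i with inBig Q i Bool.≟ true
  ... | no ¬bigⁱ = begin
    permInv b (γ i)    ≡⟨ cong (permInv b) (γ-suc y≡1+i) ⟩
    permInv b y        ≡⟨ permInv-prev b i<y (continues′ y≡1+i (¬-not ¬bigⁱ))
                             (λ k i<k k<y _ → nothing-between y≡1+i i<k k<y) ⟩
    i                  ≡⟨ perm-partQ-small Q (¬-not ¬bigⁱ) ⟨
    perm (partQ Q) i   ∎
    where
    open ≡-Reasoning
    i<y : toℕ i < toℕ y
    i<y = ℕ.≤-reflexive (sym y≡1+i)
  ... | yes bigⁱ = begin
    permInv b (γ i)    ≡⟨ cong (permInv b) (γ-suc y≡1+i) ⟩
    permInv b y        ≡⟨ permInv-blockStart
                             (λ j j<y → separated bigⁱ (s≤s⁻¹ (subst (toℕ j <_) y≡1+i j<y)) i<y) nb ⟩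
    next nb            ≡⟨ perm-partQ-big Q bigⁱ y≡1+i ⟨
    perm (partQ Q) i   ∎
    where
    open ≡-Reasoning
    nb : NextBig Q y
    nb = nextBig Q y
    i<y : toℕ i < toℕ y
    i<y = ℕ.≤-reflexive (sym y≡1+i)

  Kr-last : ∀ {i} → toℕ i ≡ m → Kr b i ≡ perm (partQ Q) i
  Kr-last {i} i≡m = begin
    permInv b (γ i)        ≡⟨ cong (permInv b) (γ-last i≡m) ⟩
    permInv b Fin.zero     ≡⟨ permInv-blockStart (λ _ ()) nb ⟩
    next nb                ≡⟨ perm-partQ-wrap Q (inBig-last Q i i≡m)
                                (λ k i<k _ → ℕ.<⇒≱ i<k (last-maximal i≡m))
                                (isBig nb) (λ k → skipped nb k z≤n) ⟨
    perm (partQ Q) i       ∎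
    where
    open ≡-Reasoning
    nb : NextBig Q Fin.zero
    nb = nextBig Q Fin.zero

  Kr-interval : ∀ i → Kr b i ≡ perm (partQ Q) i
  Kr-interval i with toℕ i <? m
  ... | yes i<m = Kr-beforeLast (toℕ-fromℕ< (s≤s i<m))
  ... | no  i≮m = Kr-last (ℕ.≤-antisym (s≤s⁻¹ (toℕ<n i)) (ℕ.≮⇒≥ i≮m))

blockEnds : ∀ {m} → Labelling (suc m) → Subset m
blockEnds b = Vec.tabulate λ k → not (does (b (inject₁ k) ℕ.≟ b (Fin.suc k)))

blockEnds-BlockEnds : ∀ {m} (b : Labelling (suc m)) → BlockEnds b (blockEnds b)
blockEnds-BlockEnds b = record { continues = continues ; breaks = breaks }
  where
  adjacent? : ∀ k → Dec (b (inject₁ k) ≡ b (Fin.suc k))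
  adjacent? k = b (inject₁ k) ℕ.≟ b (Fin.suc k)

  lookup-blockEnds : ∀ k → lookup (blockEnds b) k ≡ not (does (adjacent? k))
  lookup-blockEnds = lookup∘tabulate _

  continues : ∀ k → lookup (blockEnds b) k ≡ false → b (inject₁ k) ≡ b (Fin.suc k)
  continues k notEnd = decidable-stable (adjacent? k) λ differ →
    contradiction (trans (sym (cong not (dec-false (adjacent? k) differ)))
                         (trans (sym (lookup-blockEnds k)) notEnd)) λ ()

  breaks : ∀ k → lookup (blockEnds b) k ≡ true → b (inject₁ k) ≢ b (Fin.suc k)
  breaks k end same =
    contradiction (trans (sym (cong not (dec-true (adjacent? k) same)))
                         (trans (sym (lookup-blockEnds k)) end)) λ ()

monotone⇒isInterval : ∀ {n} (b : Labelling n) → (∀ {i j} → toℕ i ≤ toℕ j → b i ≤ b j) →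
                      IsInterval b
monotone⇒isInterval b mono i j k i<j j<k same =
  ℕ.≤-antisym (ℕ.≤-trans (mono (ℕ.<⇒≤ j<k)) (ℕ.≤-reflexive (sym same))) (mono (ℕ.<⇒≤ i<j))

intervalPartition : ∀ {m} → Subset m → Labelling (suc m)
intervalPartition _        Fin.zero    = 0
intervalPartition (q ∷ᵥ Q) (Fin.suc i) = (if q then 1 else 0) + intervalPartition Q i

intervalPartition-mono : ∀ {m} (Q : Subset m) {i j} → toℕ i ≤ toℕ j →
                         intervalPartition Q i ≤ intervalPartition Q j
intervalPartition-mono Q        {Fin.zero}              _         = z≤n
intervalPartition-mono (q ∷ᵥ Q) {Fin.suc i} {Fin.suc j} (s≤s i≤j) =
  ℕ.+-monoʳ-≤ (if q then 1 else 0) (intervalPartition-mono Q i≤j)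

intervalPartition-stays : ∀ {m} (Q : Subset m) k → lookup Q k ≡ false →
                          intervalPartition Q (inject₁ k) ≡ intervalPartition Q (Fin.suc k)
intervalPartition-stays (_ ∷ᵥ _) Fin.zero    refl  = refl
intervalPartition-stays (q ∷ᵥ Q) (Fin.suc k) small =
  cong ((if q then 1 else 0) +_) (intervalPartition-stays Q k small)

intervalPartition-increments : ∀ {m} (Q : Subset m) k → lookup Q k ≡ true →
                               intervalPartition Q (Fin.suc k) ≡ suc (intervalPartition Q (inject₁ k))
intervalPartition-increments (_ ∷ᵥ _) Fin.zero    refl = refl
intervalPartition-increments (q ∷ᵥ Q) (Fin.suc k) big  =
  trans (cong ((if q then 1 else 0) +_) (intervalPartition-increments Q k big)) (ℕ.+-suc _ _)

intervalPartition-BlockEnds : ∀ {m} (Q : Subset m) → BlockEnds (intervalPartition Q) Q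
intervalPartition-BlockEnds Q = record
  { continues = intervalPartition-stays Q
  ; breaks    = λ k big same → ℕ.1+n≢n (sym (trans same (intervalPartition-increments Q k big)))
  }

inBig≡moves : ∀ {m} (Q : Subset m) (i : Fin (suc m)) → toℕ i < m →
              inBig Q i ≡ not (does (perm (partQ Q) i Fin.≟ i))
inBig≡moves Q i i<m with inBig Q i Bool.≟ true
... | yes big = trans big (cong not (sym (dec-false (perm (partQ Q) i Fin.≟ i) moves)))
  where
  y≡1+i : toℕ (fromℕ< (s≤s i<m)) ≡ suc (toℕ i)
  y≡1+i = toℕ-fromℕ< (s≤s i<m)
  moves : perm (partQ Q) i ≢ i
  moves fixed = ℕ.<-irrefl (cong toℕ (trans (sym fixed) (perm-partQ-big Q big y≡1+i))) (nextBig-after Q y≡1+i)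
... | no ¬big =
  trans (¬-not ¬big) (cong not (sym (dec-true (perm (partQ Q) i Fin.≟ i) (perm-partQ-small Q (¬-not ¬big)))))

perm-partQ-injective : ∀ {m} (Q Q′ : Subset m) → (∀ i → perm (partQ Q) i ≡ perm (partQ Q′) i) →
                       Q ≡ Q′
perm-partQ-injective Q Q′ samePerm = begin
  Q                        ≡⟨ tabulate∘lookup Q ⟨
  Vec.tabulate (lookup Q)  ≡⟨ tabulate-cong sameLookup ⟩
  Vec.tabulate (lookup Q′) ≡⟨ tabulate∘lookup Q′ ⟩
  Q′                       ∎
  where
  open ≡-Reasoning
  sameLookup : ∀ k → lookup Q k ≡ lookup Q′ k
  sameLookup k = begin
    lookup Q k                                      ≡⟨ inBig-inject₁ Q k ⟨
    inBig Q i                                       ≡⟨ inBig≡moves Q i (inject₁ℕ< k) ⟩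
    not (does (perm (partQ Q) i Fin.≟ i))           ≡⟨ cong (λ j → not (does (j Fin.≟ i))) (samePerm i) ⟩
    not (does (perm (partQ Q′) i Fin.≟ i))          ≡⟨ inBig≡moves Q′ i (inject₁ℕ< k) ⟨
    inBig Q′ i                                      ≡⟨ inBig-inject₁ Q′ k ⟩
    lookup Q′ k                                     ∎
    where
    i = inject₁ k

lemma3p9 : (m : ℕ) →
    ((σ : Fin (suc m) → Fin (suc m)) →
      (InKrInt (suc m) σ → Σ (Subset m) (λ Q → ∀ i → σ i ≡ perm (partQ Q) i))
      × (Σ (Subset m) (λ Q → ∀ i → σ i ≡ perm (partQ Q) i) → InKrInt (suc m) σ))
    × ((Q Q′ : Subset m) → (∀ i → perm (partQ Q) i ≡ perm (partQ Q′) i) → Q ≡ Q′)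
lemma3p9 m = (λ σ → fromKrInt σ , toKrInt σ) , perm-partQ-injective
  where
  open KrewerasOfInterval using (Kr-interval)

  fromKrInt : ∀ σ → InKrInt (suc m) σ → Σ (Subset m) (λ Q → ∀ i → σ i ≡ perm (partQ Q) i)
  fromKrInt σ (b , interval , σ≗Kr) =
    blockEnds b , λ i → trans (σ≗Kr i) (Kr-interval interval (blockEnds-BlockEnds b) i)

  toKrInt : ∀ σ → Σ (Subset m) (λ Q → ∀ i → σ i ≡ perm (partQ Q) i) → InKrInt (suc m) σ
  toKrInt σ (Q , σ≗perm) =
    intervalPartition Q , interval ,
    λ i → trans (σ≗perm i) (sym (Kr-interval interval (intervalPartition-BlockEnds Q) i))
    where
    interval : IsInterval (intervalPartition Q)
    interval = monotone⇒isInterval (intervalPartition Q) (intervalPartition-mono Q)
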